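{- For the game of dreidel (as described in the context) played by $2$ players each starting with $N$ tokens, the expected number of spins $\mu_d$ until the game ends satisfies $\mu_d \le \frac{104}{3}N^2 + o(N^2)$ as $N \to \infty$.
   Context: Dreidel is the following random game. There are $k$ players $P_1,\dots,P_k$ (here $k=2$), each starting with $N$ tokens; at the start each player contributes one token to a common pot. The players then take turns in the cyclic order $P_1,P_2,P_1,P_2,\dots$ spinning a four-sided top; each spin independently shows one of four sides with probability $1/4$ each, and the spinner acts as follows: Nisht (N): nothing happens; Ganz (G): the spinner takes all the tokens in the pot; Halb (H): the spinner takes $\lfloor x/2 \rfloor$ tokens from the pot, where $x$ is the number of tokens in the pot; Shtel (S): the spinner donates one token to the pot. Whenever the pot becomes empty, all remaining players ante up, i.e. each donates one token to the pot. A player loses and goes home when he or she is required to donate a token to the pot but has none. The game ends when only one player (the winner) remains. A spin is one turn of one player. -}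

module Defs where

open import Data.Nat using (ℕ; zero; suc; _+_; _*_; _∸_; _/_)
open import Data.Integer using (+_)
open import Data.Rational using (ℚ; 0ℚ; 1ℚ) renaming (_+_ to _+q_; _*_ to _*q_; _/_ to _/q_)
open import Data.List using (List; []; _∷_; concatMap; map; foldr)
open import Data.Maybe using (Maybe; just; nothing)
open import Data.Product using (_×_; _,_)

-- Two-player dreidel.  A game state records, from the point of view of the
-- player who is about to spin:  (tokens of spinner , tokens of other player , pot).
record State : Set where
  constructor st
  field
    spinner : ℕ
    other   : ℕ
    pot     : ℕ

data Side : Set where
  Nisht Ganz Halb Shtel : Side

-- The returned state is already from the viewpoint of the next spinner
-- (the roles are swapped: `b` is the next spinner).
ante : (a b : ℕ) → Maybe State
ante zero    b       = nothing
ante (suc a) zero    = nothing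
ante (suc a) (suc b) = just (st b a 2)

finish : (a b x : ℕ) → Maybe State
finish a b zero      = ante a b
finish a b (suc x)   = just (st b a (suc x))

-- One spin.  `nothing` means the game has ended during this spin.
spin : Side → State → Maybe State
spin Nisht (st s o x)       = finish s o x
spin Ganz  (st s o x)       = finish (s + x) o 0
spin Halb  (st s o x)       = finish (s + x / 2) o (x ∸ x / 2)
spin Shtel (st zero o x)    = nothing
spin Shtel (st (suc s) o x) = finish s o (suc x)

-- Sub-probability distributions over live (not yet finished) states,
-- as weighted lists.
Dist : Set
Dist = List (State × ℚ)

quarter : ℚ
quarter = + 1 /q 4

step : Dist → Dist
step = concatMap λ { (σ , p) →
  concatMap (λ side → keep (spin side σ) (quarter *q p))
            (Nisht ∷ Ganz ∷ Halb ∷ Shtel ∷ []) }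
  where
  keep : Maybe State → ℚ → Dist
  keep nothing  _ = []
  keep (just τ) q = (τ , q) ∷ []

mass : Dist → ℚ
mass = foldr (λ { (_ , p) acc → p +q acc }) 0ℚ

iter : ℕ → Dist → Dist
iter zero    d = d
iter (suc k) d = step (iter k d)

-- Initial distribution: each of the two players starts with N tokens and
-- antes one; player P₁ spins first.
initial : ℕ → Dist
initial N = (st (N ∸ 1) (N ∸ 1) 2 , 1ℚ) ∷ []

-- P(T > k): probability that the game is still running after k spins,
-- where T is the number of spins until the game ends.
survival : ℕ → ℕ → ℚ
survival N k = mass (iter k (initial N))

-- E[min(T , t)] = Σ_{k<t} P(T > k).
truncatedExpectedSpins : ℕ → ℕ → ℚ
truncatedExpectedSpins N zero    = 0ℚ
truncatedExpectedSpins N (suc t) = truncatedExpectedSpins N t +q survival N t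

-- A drift argument for a quadratic potential.  In a state where the spinner holds S tokens,
-- the other player O and the pot X, let
--   Ψ = 104·S·O + (40X + 52 + 8w)·S + (64X + 30 − 8w)·O + 20X² + 30X + 100,
-- where w = W(X) depends on the pot only.  Every spin lowers the expected value of Ψ by at
-- least 10, so 10·E[min(T, t)] ≤ Ψ(initial state) = 104(N−1)² + O(N), far below (104/3)N².
--
-- Since the players swap roles at every spin, the part of the drift proportional to S − O
-- is a multiple of W + PW − parity(X), where P averages a function of the pot over its four
-- successors x, 2, ⌈x/2⌉, x + 1.  W is a truncation of the alternating series
-- Σₖ (−1)ᵏ Pᵏ(parity), which converges because P shrinks oscillations by a factor 3/4 (all
-- pots share the successor 2).  Truncating at a depth proportional to the total number of
-- tokens makes the remaining error negligible against S + O.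
module Submission where

open import Defs
open import Data.Nat using (ℕ; _≥_; _^_)
open import Data.Integer using (+_)
open import Data.Rational using (ℚ; 0ℚ; _<_; _≤_; _+_; _*_; _/_)
open import Data.Product using (∃-syntax)

open import Data.Nat using (zero; suc; _∸_; _%_; z≤n; s≤s)
import Data.Nat as ℕ
import Data.Nat.DivMod as ℕ÷
import Data.Nat.Properties as ℕₚ
open import Data.Nat.Tactic.RingSolver using () renaming (solve-∀ to ℕ-ring)
import Data.Integer as ℤ
import Data.Integer.Properties as ℤₚ
open import Data.Rational using (1ℚ; _-_; -_; _≤?_; _≟_; toℚᵘ; nonNegative)
import Data.Rational.Properties as ℚₚ
open import Data.Rational.Unnormalised using (mkℚᵘ; *≡*) renaming (_+_ to _+ᵘ_)
import Data.Rational.Unnormalised.Properties as ℚᵘₚ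
open import Data.Product using (_×_; _,_; proj₁; proj₂)
open import Data.Maybe using (Maybe; just; nothing)
open import Data.List using ([]; _∷_; _++_; concatMap)
open import Data.List.Relation.Unary.All using (All; []; _∷_)
open import Data.List.Relation.Unary.All.Properties using (++⁺)
open import Level using (0ℓ)
open import Relation.Binary.PropositionalEquality
open import Relation.Nullary.Decidable using (True; toWitness; dec⇒maybe)
open import Tactic.RingSolver using (solve-∀)
open import Tactic.RingSolver.Core.AlmostCommutativeRing using (AlmostCommutativeRing; fromCommutativeRing)

-- Arithmetic in ℚ

ℚ-ring : AlmostCommutativeRing 0ℓ 0ℓ
ℚ-ring = fromCommutativeRing ℚₚ.+-*-commutativeRing (λ x → dec⇒maybe (0ℚ ≟ x))

≤-decide : (p q : ℚ) → {True (p ≤? q)} → p ≤ q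
≤-decide p q {p≤q} = toWitness p≤q

≤-by-slack : ∀ {p q} r → q ≡ p + r → 0ℚ ≤ r → p ≤ q
≤-by-slack {p} {q} r q≡p+r 0≤r = begin
  p      ≡⟨ ℚₚ.+-identityʳ p ⟨
  p + 0ℚ ≤⟨ ℚₚ.+-monoʳ-≤ p 0≤r ⟩
  p + r  ≡⟨ q≡p+r ⟨
  q      ∎
  where open ℚₚ.≤-Reasoning

0≤+ : ∀ {p q} → 0ℚ ≤ p → 0ℚ ≤ q → 0ℚ ≤ p + q
0≤+ = ℚₚ.+-mono-≤

0≤* : ∀ {p q} → 0ℚ ≤ p → 0ℚ ≤ q → 0ℚ ≤ p * q
0≤* {p} {q} 0≤p 0≤q = ℚₚ.nonNegative⁻¹ (p * q)
  {{ℚₚ.nonNeg*nonNeg⇒nonNeg p {{nonNegative 0≤p}} q {{nonNegative 0≤q}}}}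

p≤q⇒0≤q-p : ∀ {p q} → p ≤ q → 0ℚ ≤ q - p
p≤q⇒0≤q-p {p} {q} p≤q = subst (_≤ q - p) (ℚₚ.+-inverseʳ p) (ℚₚ.+-monoˡ-≤ (- p) p≤q)

-p≤q⇒0≤q+p : ∀ {p q} → - p ≤ q → 0ℚ ≤ q + p
-p≤q⇒0≤q+p {p} {q} -p≤q = subst (0ℚ ≤_) (minus-neg q p) (p≤q⇒0≤q-p -p≤q)
  where
  minus-neg : ∀ q p → q - - p ≡ q + p
  minus-neg = solve-∀ ℚ-ring

-‿mono-≤ : ∀ {p p′ q q′} → p ≤ p′ → q′ ≤ q → p - q ≤ p′ - q′
-‿mono-≤ p≤p′ q′≤q = ℚₚ.+-mono-≤ p≤p′ (ℚₚ.neg-antimono-≤ q′≤q)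

ι : ℕ → ℚ
ι n = + n / 1

ι-+ : ∀ m n → ι (m ℕ.+ n) ≡ ι m + ι n
ι-+ m n = ℚₚ.toℚᵘ-injective (begin
  toℚᵘ (ι (m ℕ.+ n))            ≈⟨ ℚₚ.toℚᵘ-fromℚᵘ (mkℚᵘ (+ (m ℕ.+ n)) 0) ⟩
  mkℚᵘ (+ (m ℕ.+ n)) 0          ≈⟨ *≡* numerators ⟩
  mkℚᵘ (+ m) 0 +ᵘ mkℚᵘ (+ n) 0  ≈⟨ ℚᵘₚ.+-cong (ℚₚ.toℚᵘ-fromℚᵘ (mkℚᵘ (+ m) 0)) (ℚₚ.toℚᵘ-fromℚᵘ (mkℚᵘ (+ n) 0)) ⟨
  toℚᵘ (ι m) +ᵘ toℚᵘ (ι n)      ≈⟨ ℚₚ.toℚᵘ-homo-+ (ι m) (ι n) ⟨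
  toℚᵘ (ι m + ι n)              ∎)
  where
  open ℚᵘₚ.≃-Reasoning
  numerators : + (m ℕ.+ n) ℤ.* + 1 ≡ (+ m ℤ.* + 1 ℤ.+ + n ℤ.* + 1) ℤ.* + 1
  numerators rewrite ℤₚ.*-identityʳ (+ m) | ℤₚ.*-identityʳ (+ n) = refl

ι-suc : ∀ n → ι (suc n) ≡ 1ℚ + ι n
ι-suc = ι-+ 1

ι-pred : ∀ n → ι n ≡ ι (suc n) - 1ℚ
ι-pred n = trans (shift (ι n)) (cong (_- 1ℚ) (sym (ι-suc n)))
  where
  shift : ∀ a → a ≡ (1ℚ + a) - 1ℚ
  shift = solve-∀ ℚ-ring

ι-+-pred : ∀ m n → ι (m ℕ.+ n) ≡ ι m + ι (suc n) - 1ℚ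
ι-+-pred m n = trans (ι-+ m n) (trans (shift (ι m) (ι n)) (cong (λ r → ι m + r - 1ℚ) (sym (ι-suc n))))
  where
  shift : ∀ a b → a + b ≡ a + (1ℚ + b) - 1ℚ
  shift = solve-∀ ℚ-ring

ι-* : ∀ m n → ι (m ℕ.* n) ≡ ι m * ι n
ι-* zero    n = sym (ℚₚ.*-zeroˡ (ι n))
ι-* (suc m) n = begin
  ι (n ℕ.+ m ℕ.* n)  ≡⟨ ι-+ n (m ℕ.* n) ⟩
  ι n + ι (m ℕ.* n)  ≡⟨ cong (_+_ (ι n)) (ι-* m n) ⟩
  ι n + ι m * ι n    ≡⟨ distrib (ι m) (ι n) ⟩
  (1ℚ + ι m) * ι n   ≡⟨ cong (_* ι n) (ι-suc m) ⟨
  ι (suc m) * ι n    ∎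
  where
  open ≡-Reasoning
  distrib : ∀ a b → b + a * b ≡ (1ℚ + a) * b
  distrib = solve-∀ ℚ-ring

ι-square : ∀ n → ι (n ^ 2) ≡ ι n * ι n
ι-square n = trans (cong (λ r → ι (n ℕ.* r)) (ℕₚ.*-identityʳ n)) (ι-* n n)

0≤ι : ∀ n → 0ℚ ≤ ι n
0≤ι zero    = ℚₚ.≤-refl
0≤ι (suc n) = subst (0ℚ ≤_) (sym (ι-suc n)) (0≤+ (≤-decide 0ℚ 1ℚ) (0≤ι n))

ι-mono-≤ : ∀ {m n} → m ℕ.≤ n → ι m ≤ ι n
ι-mono-≤ {m} {n} m≤n = ≤-by-slack (ι (n ∸ m))
  (trans (cong ι (sym (ℕₚ.m+[n∸m]≡n m≤n))) (ι-+ m (n ∸ m))) (0≤ι (n ∸ m))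

ι≤ι*ι : ∀ n → ι n ≤ ι n * ι n
ι≤ι*ι n = subst (ι n ≤_) (ι-* n n) (ι-mono-≤ (n≤n*n n))
  where
  n≤n*n : ∀ n → n ℕ.≤ n ℕ.* n
  n≤n*n zero    = z≤n
  n≤n*n (suc n) = ℕₚ.m≤m*n (suc n) (suc n)

½ ¾ : ℚ
½ = + 1 / 2
¾ = + 3 / 4

¾^ : ℕ → ℚ
¾^ zero    = 1ℚ
¾^ (suc n) = ¾ * ¾^ n

0≤¾^ : ∀ n → 0ℚ ≤ ¾^ n
0≤¾^ zero    = ≤-decide 0ℚ 1ℚ
0≤¾^ (suc n) = 0≤* (≤-decide 0ℚ ¾) (0≤¾^ n)

double : ℕ → ℕ
double zero    = zero
double (suc m) = suc (suc (double m))

linear*¾^double≤2 : ∀ k → ι (suc k) * ¾^ (double k) ≤ ι 2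
linear*¾^double≤2 zero          = ≤-decide _ _
linear*¾^double≤2 (suc zero)    = ≤-decide _ _
linear*¾^double≤2 (suc (suc k)) = ℚₚ.≤-trans decreasing (linear*¾^double≤2 (suc k))
  where
  g = ¾^ (double (suc k))
  slack = + 1 / 16 * (g * (ι 5 + ι 7 * ι k))
  decreasing : ι (3 ℕ.+ k) * (¾ * (¾ * g)) ≤ ι (2 ℕ.+ k) * g
  decreasing = ≤-by-slack slack
    (begin
      ι (2 ℕ.+ k) * g                      ≡⟨ cong (_* g) (ι-+ 2 k) ⟩
      (ι 2 + ι k) * g                      ≡⟨ identity g (ι k) ⟩
      (ι 3 + ι k) * (¾ * (¾ * g)) + slack  ≡⟨ cong (λ r → r * (¾ * (¾ * g)) + slack) (ι-+ 3 k) ⟨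
      ι (3 ℕ.+ k) * (¾ * (¾ * g)) + slack  ∎)
    (0≤* (≤-decide 0ℚ (+ 1 / 16)) (0≤* (0≤¾^ (double (suc k))) (0≤+ (0≤ι 5) (0≤* (0≤ι 7) (0≤ι k)))))
    where
    open ≡-Reasoning
    identity : ∀ g K → (ι 2 + K) * g ≡ (ι 3 + K) * (¾ * (¾ * g)) + + 1 / 16 * (g * (ι 5 + ι 7 * K))
    identity = solve-∀ ℚ-ring

-- The pot chain and the corrector

average : ℚ → ℚ → ℚ → ℚ → ℚ
average a b c d = quarter * (a + b + c + d)

average-mono-≤ : ∀ {a b c d a′ b′ c′ d′} → a ≤ a′ → b ≤ b′ → c ≤ c′ → d ≤ d′ →
                 average a b c d ≤ average a′ b′ c′ d′
average-mono-≤ a≤ b≤ c≤ d≤ =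
  ℚₚ.*-monoˡ-≤-nonNeg quarter (ℚₚ.+-mono-≤ (ℚₚ.+-mono-≤ (ℚₚ.+-mono-≤ a≤ b≤) c≤) d≤)

average-const : ∀ c → average c c c c ≡ c
average-const = identity
  where
  identity : ∀ c → quarter * (c + c + c + c) ≡ c
  identity = solve-∀ ℚ-ring

average-+ : ∀ a b c d a′ b′ c′ d′ →
            average a b c d + average a′ b′ c′ d′ ≡ average (a + a′) (b + b′) (c + c′) (d + d′)
average-+ = identity
  where
  identity : ∀ a b c d a′ b′ c′ d′ → quarter * (a + b + c + d) + quarter * (a′ + b′ + c′ + d′)
             ≡ quarter * ((a + a′) + (b + b′) + (c + c′) + (d + d′))
  identity = solve-∀ ℚ-ring

average-- : ∀ a b c d a′ b′ c′ d′ →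
            average a b c d - average a′ b′ c′ d′ ≡ average (a - a′) (b - b′) (c - c′) (d - d′)
average-- = identity
  where
  identity : ∀ a b c d a′ b′ c′ d′ → quarter * (a + b + c + d) - quarter * (a′ + b′ + c′ + d′)
             ≡ quarter * ((a - a′) + (b - b′) + (c - c′) + (d - d′))
  identity = solve-∀ ℚ-ring

average-−-const : ∀ a b c d e → average a b c d - e ≡ average (a - e) (b - e) (c - e) (d - e)
average-−-const = identity
  where
  identity : ∀ a b c d e → quarter * (a + b + c + d) - e ≡ quarter * ((a - e) + (b - e) + (c - e) + (d - e))
  identity = solve-∀ ℚ-ring

const-−-average : ∀ a b c d e → e - average a b c d ≡ average (e - a) (e - b) (e - c) (e - d)
const-−-average = identity
  where
  identity : ∀ a b c d e → e - quarter * (a + b + c + d) ≡ quarter * ((e - a) + (e - b) + (e - c) + (e - d))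
  identity = solve-∀ ℚ-ring

halbPot : ℕ → ℕ
halbPot x = x ∸ x ℕ./ 2

halving : ∀ x → x ≡ x ℕ./ 2 ℕ.+ x ℕ./ 2 ℕ.+ x % 2
halving x = trans (ℕ÷.m≡m%n+[m/n]*n x 2) (rearrange (x % 2) (x ℕ./ 2))
  where
  rearrange : ∀ e h → e ℕ.+ h ℕ.* 2 ≡ h ℕ.+ h ℕ.+ e
  rearrange = ℕ-ring

halbPot-halving : ∀ x → halbPot x ≡ x ℕ./ 2 ℕ.+ x % 2
halbPot-halving x = begin
  x ∸ h                ≡⟨ cong (_∸ h) (halving x) ⟩
  h ℕ.+ h ℕ.+ e ∸ h    ≡⟨ cong (_∸ h) (ℕₚ.+-assoc h h e) ⟩
  h ℕ.+ (h ℕ.+ e) ∸ h  ≡⟨ ℕₚ.m+n∸m≡n h (h ℕ.+ e) ⟩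
  h ℕ.+ e              ∎
  where
  open ≡-Reasoning
  h = x ℕ./ 2
  e = x % 2

ι-halving : ∀ x → ι x ≡ ι (x ℕ./ 2) + ι (x ℕ./ 2) + ι (x % 2)
ι-halving x = trans (cong ι (halving x))
  (trans (ι-+ (x ℕ./ 2 ℕ.+ x ℕ./ 2) (x % 2)) (cong (_+ ι (x % 2)) (ι-+ (x ℕ./ 2) (x ℕ./ 2))))

ι-halbPot : ∀ x → ι (halbPot x) ≡ ι (x ℕ./ 2) + ι (x % 2)
ι-halbPot x = trans (cong ι (halbPot-halving x)) (ι-+ (x ℕ./ 2) (x % 2))

-- One spin moves the pot x to x (Nisht), 2 (Ganz, then the ante), ⌈x/2⌉ (Halb) or x + 1 (Shtel).
potAverage : (ℕ → ℚ) → ℕ → ℚ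
potAverage f x = average (f x) (f 2) (f (halbPot x)) (f (suc x))

potAverage-bounded : ∀ {f lo hi} → (∀ z → lo ≤ f z) → (∀ z → f z ≤ hi) →
                     ∀ x → lo ≤ potAverage f x × potAverage f x ≤ hi
potAverage-bounded {f} {lo} {hi} lo≤f f≤hi x =
    subst (_≤ potAverage f x) (average-const lo) (average-mono-≤ (lo≤f _) (lo≤f _) (lo≤f _) (lo≤f _))
  , subst (potAverage f x ≤_) (average-const hi) (average-mono-≤ (f≤hi _) (f≤hi _) (f≤hi _) (f≤hi _))

parity : ℕ → ℚ
parity x = ι (x % 2)

parity≤1 : ∀ x → parity x ≤ 1ℚ
parity≤1 x = ι-mono-≤ (ℕₚ.≤-pred (ℕ÷.m%n<n x 2))

smoothedParity : ℕ → ℕ → ℚ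
smoothedParity zero    = parity
smoothedParity (suc n) = potAverage (smoothedParity n)

smoothedParity-bounded : ∀ n x → 0ℚ ≤ smoothedParity n x × smoothedParity n x ≤ 1ℚ
smoothedParity-bounded zero    x = 0≤ι (x % 2) , parity≤1 x
smoothedParity-bounded (suc n) x =
  potAverage-bounded (λ z → proj₁ (smoothedParity-bounded n z)) (λ z → proj₂ (smoothedParity-bounded n z)) x

smoothedParity-oscillation : ∀ n x y → smoothedParity n x - smoothedParity n y ≤ ¾^ n
smoothedParity-oscillation zero    x y = -‿mono-≤ (parity≤1 x) (0≤ι (y % 2))
smoothedParity-oscillation (suc n) x y = begin
  potAverage T x - potAverage T y
    ≡⟨ average-- (T x) (T 2) (T (halbPot x)) (T (suc x)) (T y) (T 2) (T (halbPot y)) (T (suc y)) ⟩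
  average (T x - T y) (T 2 - T 2) (T (halbPot x) - T (halbPot y)) (T (suc x) - T (suc y))
    ≤⟨ average-mono-≤ (smoothedParity-oscillation n x y) (ℚₚ.≤-reflexive (ℚₚ.+-inverseʳ (T 2)))
                      (smoothedParity-oscillation n _ _) (smoothedParity-oscillation n _ _) ⟩
  average (¾^ n) 0ℚ (¾^ n) (¾^ n)
    ≡⟨ shared-successor-drops (¾^ n) ⟩
  ¾ * ¾^ n ∎
  where
  open ℚₚ.≤-Reasoning
  T = smoothedParity n
  shared-successor-drops : ∀ g → quarter * (g + 0ℚ + g + g) ≡ ¾ * g
  shared-successor-drops = solve-∀ ℚ-ring

smoothedParity-step : ∀ n x → smoothedParity (suc n) x - smoothedParity n x ≤ ¾^ n
                            × smoothedParity n x - smoothedParity (suc n) x ≤ ¾^ n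
smoothedParity-step n x =
    subst₂ _≤_ (sym (average-−-const (T x) (T 2) (T (halbPot x)) (T (suc x)) (T x))) (average-const (¾^ n))
      (average-mono-≤ (osc x x) (osc 2 x) (osc (halbPot x) x) (osc (suc x) x))
  , subst₂ _≤_ (sym (const-−-average (T x) (T 2) (T (halbPot x)) (T (suc x)) (T x))) (average-const (¾^ n))
      (average-mono-≤ (osc x x) (osc x 2) (osc x (halbPot x)) (osc x (suc x)))
  where
  T = smoothedParity n
  osc = smoothedParity-oscillation n

halfSecondDifference : ℕ → ℕ → ℚ
halfSecondDifference k x =
  ½ * smoothedParity k x - smoothedParity (suc k) x + ½ * smoothedParity (suc (suc k)) x

-- corrector m = T₀ − T₁ + T₂ − ⋯ − T_{2m−1} + ½ T_{2m}, where Tₖ = smoothedParity k.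
corrector : ℕ → ℕ → ℚ
corrector zero    x = ½ * parity x
corrector (suc m) x = corrector m x + halfSecondDifference (double m) x

potAverage-halfSecondDifference : ∀ k x →
  potAverage (halfSecondDifference k) x ≡ halfSecondDifference (suc k) x
potAverage-halfSecondDifference k x = linearity
  (T k x) (T k 2) (T k (halbPot x)) (T k (suc x))
  (T (suc k) x) (T (suc k) 2) (T (suc k) (halbPot x)) (T (suc k) (suc x))
  (T (suc (suc k)) x) (T (suc (suc k)) 2) (T (suc (suc k)) (halbPot x)) (T (suc (suc k)) (suc x))
  where
  T = smoothedParity
  linearity : ∀ a₁ a₂ a₃ a₄ b₁ b₂ b₃ b₄ c₁ c₂ c₃ c₄ →
    quarter * ((½ * a₁ - b₁ + ½ * c₁) + (½ * a₂ - b₂ + ½ * c₂) + (½ * a₃ - b₃ + ½ * c₃) + (½ * a₄ - b₄ + ½ * c₄))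
    ≡ ½ * (quarter * (a₁ + a₂ + a₃ + a₄)) - quarter * (b₁ + b₂ + b₃ + b₄) + ½ * (quarter * (c₁ + c₂ + c₃ + c₄))
  linearity = solve-∀ ℚ-ring

corrector-equation : ∀ m x → corrector m x + potAverage (corrector m) x
                           ≡ parity x + ½ * (smoothedParity (suc (double m)) x - smoothedParity (double m) x)
corrector-equation zero x = base (parity x) (parity 2) (parity (halbPot x)) (parity (suc x))
  where
  base : ∀ a b c d → ½ * a + quarter * (½ * a + ½ * b + ½ * c + ½ * d)
                     ≡ a + ½ * (quarter * (a + b + c + d) - a)
  base = solve-∀ ℚ-ring
corrector-equation (suc m) x = begin
  W′ x + potAverage W′ x
    ≡⟨ cong (_+_ (W′ x)) (sym (average-+ (W x) (W 2) (W (halbPot x)) (W (suc x)) _ _ _ _)) ⟩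
  (W x + δ x) + (potAverage W x + potAverage δ x)
    ≡⟨ regroup (W x) (δ x) (potAverage W x) (potAverage δ x) ⟩
  (W x + potAverage W x) + (δ x + potAverage δ x)
    ≡⟨ cong₂ _+_ (corrector-equation m x) (cong (_+_ (δ x)) (potAverage-halfSecondDifference k x)) ⟩
  (parity x + ½ * (T (suc k) x - T k x)) + (δ x + halfSecondDifference (suc k) x)
    ≡⟨ telescope (parity x) (T k x) (T (suc k) x) (T (suc (suc k)) x) (T (suc (suc (suc k))) x) ⟩
  parity x + ½ * (T (suc (suc (suc k))) x - T (suc (suc k)) x) ∎
  where
  open ≡-Reasoning
  T = smoothedParity
  k = double m
  W = corrector m
  W′ = corrector (suc m)
  δ = halfSecondDifference k
  regroup : ∀ a b c d → (a + b) + (c + d) ≡ (a + c) + (b + d)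
  regroup = solve-∀ ℚ-ring
  telescope : ∀ p t₀ t₁ t₂ t₃ →
    (p + ½ * (t₁ - t₀)) + ((½ * t₀ - t₁ + ½ * t₂) + (½ * t₁ - t₂ + ½ * t₃)) ≡ p + ½ * (t₃ - t₂)
  telescope = solve-∀ ℚ-ring

correctorSlack : ℕ → ℚ
correctorSlack m = + 5 / 2 * (1ℚ - ¾^ (double m))

correctorSlack-step : ∀ m → correctorSlack m + ¾^ (double m) ≤ correctorSlack (suc m)
correctorSlack-step m = ≤-by-slack (+ 3 / 32 * g) (identity g) (0≤* (≤-decide 0ℚ (+ 3 / 32)) (0≤¾^ (double m)))
  where
  g = ¾^ (double m)
  identity : ∀ g → + 5 / 2 * (1ℚ - ¾ * (¾ * g)) ≡ (+ 5 / 2 * (1ℚ - g) + g) + + 3 / 32 * g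
  identity = solve-∀ ℚ-ring

correctorSlack≤5/2 : ∀ m → correctorSlack m ≤ + 5 / 2
correctorSlack≤5/2 m = ≤-by-slack (+ 5 / 2 * g) (identity g) (0≤* (≤-decide 0ℚ (+ 5 / 2)) (0≤¾^ (double m)))
  where
  g = ¾^ (double m)
  identity : ∀ g → + 5 / 2 ≡ + 5 / 2 * (1ℚ - g) + + 5 / 2 * g
  identity = solve-∀ ℚ-ring

corrector-near : ∀ m x → let D = corrector m x - ½ * smoothedParity (double m) x in
                 - correctorSlack m ≤ D × D ≤ correctorSlack m
corrector-near zero x = subst (0ℚ ≤_) (sym D≡0) ℚₚ.≤-refl , subst (_≤ 0ℚ) (sym D≡0) ℚₚ.≤-refl
  where
  D≡0 : ½ * parity x - ½ * parity x ≡ 0ℚ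
  D≡0 = ℚₚ.+-inverseʳ (½ * parity x)
corrector-near (suc m) x = lower , upper
  where
  open ℚₚ.≤-Reasoning
  T = smoothedParity
  k = double m
  c = correctorSlack m
  g = ¾^ k
  D = corrector m x - ½ * T k x
  D′ = corrector (suc m) x - ½ * T (suc (suc k)) x
  ih = corrector-near m x
  T-step = smoothedParity-step k x
  shift : ∀ w a b c → (w + (½ * a - b + ½ * c)) - ½ * c ≡ (w - ½ * a) + (a - b)
  shift = solve-∀ ℚ-ring
  D′≡ : D′ ≡ D + (T k x - T (suc k) x)
  D′≡ = shift (corrector m x) (T k x) (T (suc k) x) (T (suc (suc k)) x)
  flip : ∀ a b → - (b - a) ≡ a - b
  flip = solve-∀ ℚ-ring
  neg-+ : ∀ a b → - (a + b) ≡ - a + - b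
  neg-+ = solve-∀ ℚ-ring
  upper : D′ ≤ correctorSlack (suc m)
  upper = begin
    D′                         ≡⟨ D′≡ ⟩
    D + (T k x - T (suc k) x)  ≤⟨ ℚₚ.+-mono-≤ (proj₂ ih) (proj₂ T-step) ⟩
    c + g                      ≤⟨ correctorSlack-step m ⟩
    correctorSlack (suc m)     ∎
  lower : - correctorSlack (suc m) ≤ D′
  lower = begin
    - correctorSlack (suc m)   ≤⟨ ℚₚ.neg-antimono-≤ (correctorSlack-step m) ⟩
    - (c + g)                  ≡⟨ neg-+ c g ⟩
    - c + - g                  ≤⟨ ℚₚ.+-mono-≤ (proj₁ ih)
                                    (subst (- g ≤_) (flip (T k x) (T (suc k) x)) (ℚₚ.neg-antimono-≤ (proj₁ T-step))) ⟩
    D + (T k x - T (suc k) x)  ≡⟨ D′≡ ⟨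
    D′                         ∎

corrector-bounded : ∀ m x → - ι 3 ≤ corrector m x × corrector m x ≤ ι 3
corrector-bounded m x = lower , upper
  where
  open ℚₚ.≤-Reasoning
  T = smoothedParity (double m) x
  D = corrector m x - ½ * T
  T-bounds = smoothedParity-bounded (double m) x
  split : ∀ w t → w ≡ (w - ½ * t) + ½ * t
  split = solve-∀ ℚ-ring
  upper : corrector m x ≤ ι 3
  upper = begin
    corrector m x     ≡⟨ split (corrector m x) T ⟩
    D + ½ * T         ≤⟨ ℚₚ.+-mono-≤ (ℚₚ.≤-trans (proj₂ (corrector-near m x)) (correctorSlack≤5/2 m))
                                     (ℚₚ.*-monoˡ-≤-nonNeg ½ (proj₂ T-bounds)) ⟩
    + 5 / 2 + ½ * 1ℚ  ≡⟨⟩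
    ι 3               ∎
  lower : - ι 3 ≤ corrector m x
  lower = begin
    - ι 3                 ≤⟨ ≤-decide (- ι 3) (- (+ 5 / 2) + ½ * 0ℚ) ⟩
    - (+ 5 / 2) + ½ * 0ℚ  ≤⟨ ℚₚ.+-mono-≤ (ℚₚ.≤-trans (ℚₚ.neg-antimono-≤ (correctorSlack≤5/2 m))
                                                    (proj₁ (corrector-near m x)))
                                         (ℚₚ.*-monoˡ-≤-nonNeg ½ (proj₁ T-bounds)) ⟩
    D + ½ * T             ≡⟨ split (corrector m x) T ⟨
    corrector m x         ∎

-- The potential

-- Ψ is passed to a continuation as a literal λ, so that statements `withΨ λ Ψ → …`
-- show the polynomial itself to solve-∀.
withΨ : ∀ {ℓ} {A : Set ℓ} → ((ℚ → ℚ → ℚ → ℚ → ℚ) → A) → A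
withΨ k = k λ S O X w → ι 104 * S * O + (ι 40 * X + ι 52 + ι 8 * w) * S + (ι 64 * X + ι 30 - ι 8 * w) * O
                      + ι 20 * X * X + ι 30 * X + ι 100

Ψ : ℚ → ℚ → ℚ → ℚ → ℚ
Ψ = withΨ λ ψ → ψ

0≤Ψ : ∀ {S O X w} → 0ℚ ≤ S → 0ℚ ≤ O → 0ℚ ≤ X → - ι 3 ≤ w → w ≤ ι 3 → 0ℚ ≤ Ψ S O X w
0≤Ψ {S} {O} {X} {w} 0≤S 0≤O 0≤X -3≤w w≤3 = subst (0ℚ ≤_) (sym (regroup S O X w))
  (0≤+ (0≤+ (0≤+ (0≤+ (0≤+ (0≤* (0≤* (0≤ι 104) 0≤S) 0≤O)
    (0≤* (0≤+ (0≤+ (0≤* (0≤ι 40) 0≤X) (0≤* (0≤ι 8) 0≤w+3)) (0≤ι 28)) 0≤S))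
    (0≤* (0≤+ (0≤+ (0≤* (0≤ι 64) 0≤X) (0≤* (0≤ι 8) 0≤3-w)) (0≤ι 6)) 0≤O))
    (0≤* (0≤* (0≤ι 20) 0≤X) 0≤X)) (0≤* (0≤ι 30) 0≤X)) (0≤ι 100))
  where
  0≤3-w = p≤q⇒0≤q-p w≤3
  0≤w+3 = -p≤q⇒0≤q+p -3≤w
  regroup : withΨ λ Ψ → ∀ S O X w →
            Ψ S O X w ≡ ι 104 * S * O + (ι 40 * X + ι 8 * (w + ι 3) + ι 28) * S
                        + (ι 64 * X + ι 8 * (ι 3 - w) + ι 6) * O + ι 20 * X * X + ι 30 * X + ι 100
  regroup = solve-∀ ℚ-ring

-- A spin that ends the game contributes 0 to the expected potential; this is at most the
-- value of Ψ at the virtual successor in which the player who cannot pay holds −1 tokens.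
0≤Ψ-after-failed-ante : ∀ {Y w} → 0ℚ ≤ Y → w ≤ ι 3 → 0ℚ ≤ Ψ (0ℚ - 1ℚ) Y (ι 2) w
0≤Ψ-after-failed-ante {Y} {w} 0≤Y w≤3 = subst (0ℚ ≤_) (sym (regroup Y w))
  (0≤+ (0≤* (0≤+ (0≤ι 30) (0≤* (0≤ι 8) 0≤3-w)) 0≤Y) (0≤+ (0≤ι 84) (0≤* (0≤ι 8) 0≤3-w)))
  where
  0≤3-w = p≤q⇒0≤q-p w≤3
  regroup : withΨ λ Ψ → ∀ Y w → Ψ (0ℚ - 1ℚ) Y (ι 2) w ≡ (ι 30 + ι 8 * (ι 3 - w)) * Y + (ι 84 + ι 8 * (ι 3 - w))
  regroup = solve-∀ ℚ-ring

0≤Ψ-after-failed-shtel : ∀ {O Y w} → 0ℚ ≤ O → 0ℚ ≤ Y → - ι 3 ≤ w → 0ℚ ≤ Ψ O (0ℚ - 1ℚ) ((1ℚ + Y) + 1ℚ) w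
0≤Ψ-after-failed-shtel {O} {Y} {w} 0≤O 0≤Y -3≤w = subst (0ℚ ≤_) (sym (regroup O Y w))
  (0≤+ (0≤* 0≤O (0≤+ (0≤+ (0≤ι 4) (0≤* (0≤ι 40) 0≤Y)) (0≤* (0≤ι 8) 0≤w+3)))
       (0≤+ (0≤+ (0≤+ (0≤ι 58) (0≤* (0≤ι 46) 0≤Y)) (0≤* (0≤* (0≤ι 20) 0≤Y) 0≤Y)) (0≤* (0≤ι 8) 0≤w+3)))
  where
  0≤w+3 = -p≤q⇒0≤q+p -3≤w
  regroup : withΨ λ Ψ → ∀ O Y w → Ψ O (0ℚ - 1ℚ) ((1ℚ + Y) + 1ℚ) w
            ≡ O * (ι 4 + ι 40 * Y + ι 8 * (w + ι 3)) + (ι 58 + ι 46 * Y + ι 20 * Y * Y + ι 8 * (w + ι 3))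
  regroup = solve-∀ ℚ-ring

Ψ-successors : ℚ → ℚ → ℚ → ℚ → ℚ → ℚ → ℚ → ℚ → ℚ
Ψ-successors S O H E wx w₂ wc wp =
  Ψ O S (H + H + E) wx + Ψ (O - 1ℚ) (S + (H + H + E) - 1ℚ) (ι 2) w₂
  + Ψ O (S + H) (H + E) wc + Ψ O (S - 1ℚ) ((H + H + E) + 1ℚ) wp

drift₀ : ℚ → ℚ → ℚ → ℚ → ℚ → ℚ
drift₀ H E w₂ wc wp =
  ι 90 - ι 8 * wp + ι 8 * E * w₂ + ι 20 * E * E + ι 8 * H * wc + ι 16 * H * w₂ + ι 56 * H * E + ι 76 * H * H

Ψ-successors-identity : withΨ λ Ψ → ∀ S O H E wx w₂ wc wp →
  ι 4 * Ψ S O (H + H + E) wx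
  ≡ (Ψ O S (H + H + E) wx + Ψ (O - 1ℚ) (S + (H + H + E) - 1ℚ) (ι 2) w₂
     + Ψ O (S + H) (H + E) wc + Ψ O (S - 1ℚ) ((H + H + E) + 1ℚ) wp)
    + (ι 90 - ι 8 * wp + ι 8 * E * w₂ + ι 20 * E * E + ι 8 * H * wc + ι 16 * H * w₂ + ι 56 * H * E + ι 76 * H * H)
    + ι 32 * ((wx + quarter * (wx + w₂ + wc + wp)) - E) * (S - O)
Ψ-successors-identity = solve-∀ ℚ-ring

42≤drift₀ : ∀ {H E w₂ wc wp} → 0ℚ ≤ H → 0ℚ ≤ E → E ≤ 1ℚ → H ≤ H * H →
            - ι 3 ≤ w₂ → - ι 3 ≤ wc → wp ≤ ι 3 → ι 42 ≤ drift₀ H E w₂ wc wp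
42≤drift₀ {H} {E} {w₂} {wc} {wp} 0≤H 0≤E E≤1 H≤H² -3≤w₂ -3≤wc wp≤3 =
  ≤-by-slack (slack H E w₂ wc wp) (regroup H E w₂ wc wp)
    (0≤+ (0≤+ (0≤+ (0≤+ (0≤+ (0≤+ (0≤+ (0≤+ (0≤* (0≤ι 8) (p≤q⇒0≤q-p wp≤3))
      (0≤* (0≤* (0≤ι 8) 0≤E) (-p≤q⇒0≤q+p -3≤w₂))) (0≤* (0≤ι 24) (p≤q⇒0≤q-p E≤1)))
      (0≤* (0≤* (0≤ι 20) 0≤E) 0≤E)) (0≤* (0≤* (0≤ι 8) 0≤H) (-p≤q⇒0≤q+p -3≤wc)))
      (0≤* (0≤* (0≤ι 16) 0≤H) (-p≤q⇒0≤q+p -3≤w₂))) (0≤* (0≤* (0≤ι 56) 0≤H) 0≤E))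
      (0≤* (0≤ι 76) (p≤q⇒0≤q-p H≤H²))) (0≤* (0≤ι 4) 0≤H))
  where
  slack : ℚ → ℚ → ℚ → ℚ → ℚ → ℚ
  slack H E w₂ wc wp = ι 8 * (ι 3 - wp) + ι 8 * E * (w₂ + ι 3) + ι 24 * (1ℚ - E) + ι 20 * E * E
                       + ι 8 * H * (wc + ι 3) + ι 16 * H * (w₂ + ι 3) + ι 56 * H * E + ι 76 * (H * H - H) + ι 4 * H
  regroup : ∀ H E w₂ wc wp →
    ι 90 - ι 8 * wp + ι 8 * E * w₂ + ι 20 * E * E + ι 8 * H * wc + ι 16 * H * w₂ + ι 56 * H * E + ι 76 * H * H
    ≡ ι 42 + (ι 8 * (ι 3 - wp) + ι 8 * E * (w₂ + ι 3) + ι 24 * (1ℚ - E) + ι 20 * E * E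
              + ι 8 * H * (wc + ι 3) + ι 16 * H * (w₂ + ι 3) + ι 56 * H * E + ι 76 * (H * H - H) + ι 4 * H)
  regroup = solve-∀ ℚ-ring

-2≤cross-term : ∀ {S O a b g} → 0ℚ ≤ S → 0ℚ ≤ O → a - b ≤ g → b - a ≤ g → ι 16 * g * (S + O) ≤ ι 2 →
                - ι 2 ≤ ι 16 * (b - a) * (S - O)
-2≤cross-term {S} {O} {a} {b} {g} 0≤S 0≤O a-b≤g b-a≤g 16g[S+O]≤2 =
  ≤-by-slack (slack S O a b g) (regroup S O a b g)
    (0≤+ (0≤+ (0≤* (0≤* (0≤ι 16) 0≤S) (p≤q⇒0≤q-p a-b≤g)) (0≤* (0≤* (0≤ι 16) 0≤O) (p≤q⇒0≤q-p b-a≤g)))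
         (p≤q⇒0≤q-p 16g[S+O]≤2))
  where
  slack : ℚ → ℚ → ℚ → ℚ → ℚ → ℚ
  slack S O a b g = ι 16 * S * (g - (a - b)) + ι 16 * O * (g - (b - a)) + (ι 2 - ι 16 * g * (S + O))
  regroup : ∀ S O a b g → ι 16 * (b - a) * (S - O)
            ≡ - ι 2 + (ι 16 * S * (g - (a - b)) + ι 16 * O * (g - (b - a)) + (ι 2 - ι 16 * g * (S + O)))
  regroup = solve-∀ ℚ-ring

Ψ-drift : ∀ {S O H E wx w₂ wc wp a b g} →
  0ℚ ≤ S → 0ℚ ≤ O → 0ℚ ≤ H → 0ℚ ≤ E → E ≤ 1ℚ → H ≤ H * H →
  - ι 3 ≤ w₂ → - ι 3 ≤ wc → wp ≤ ι 3 →
  wx + average wx w₂ wc wp ≡ E + ½ * (b - a) →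
  a - b ≤ g → b - a ≤ g → ι 16 * g * (S + O) ≤ ι 2 →
  Ψ-successors S O H E wx w₂ wc wp + ι 40 ≤ ι 4 * Ψ S O (H + H + E) wx
Ψ-drift {S} {O} {H} {E} {wx} {w₂} {wc} {wp} {a} {b} {g}
        0≤S 0≤O 0≤H 0≤E E≤1 H≤H² -3≤w₂ -3≤wc wp≤3 equation a-b≤g b-a≤g 16g[S+O]≤2 = begin
  Σ + ι 40                                                 ≡⟨⟩
  Σ + (ι 42 + - ι 2)
    ≤⟨ ℚₚ.+-monoʳ-≤ Σ (ℚₚ.+-mono-≤ (42≤drift₀ 0≤H 0≤E E≤1 H≤H² -3≤w₂ -3≤wc wp≤3)
                                   (-2≤cross-term {a = a} {b} 0≤S 0≤O a-b≤g b-a≤g 16g[S+O]≤2)) ⟩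
  Σ + (Δ + ι 16 * (b - a) * (S - O))                       ≡⟨ halve Σ Δ S O E a b ⟩
  Σ + Δ + ι 32 * ((E + ½ * (b - a)) - E) * (S - O)         ≡⟨ cong (λ r → Σ + Δ + ι 32 * (r - E) * (S - O)) equation ⟨
  Σ + Δ + ι 32 * ((wx + average wx w₂ wc wp) - E) * (S - O) ≡⟨ Ψ-successors-identity S O H E wx w₂ wc wp ⟨
  ι 4 * Ψ S O (H + H + E) wx                               ∎
  where
  open ℚₚ.≤-Reasoning
  Σ = Ψ-successors S O H E wx w₂ wc wp
  Δ = drift₀ H E w₂ wc wp
  halve : ∀ Σ Δ S O E a b → Σ + (Δ + ι 16 * (b - a) * (S - O)) ≡ Σ + Δ + ι 32 * ((E + ½ * (b - a)) - E) * (S - O)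
  halve = solve-∀ ℚ-ring

-- States with an empty pot never occur in play (0 is a junk value).  The corrector depth
-- 16·(s + o + x) is the same for all states of a game, since no spin changes the number of tokens.
potential : State → ℚ
potential (st s o zero)      = 0ℚ
potential (st s o x@(suc _)) = Ψ (ι s) (ι o) (ι x) (corrector (16 ℕ.* (s ℕ.+ o ℕ.+ x)) x)

potential-at : ∀ {a b z M} → 1 ℕ.≤ z → a ℕ.+ b ℕ.+ z ≡ M →
               potential (st a b z) ≡ Ψ (ι a) (ι b) (ι z) (corrector (16 ℕ.* M) z)
potential-at {z = suc _} _ refl = refl

0≤potential : ∀ σ → 0ℚ ≤ potential σ
0≤potential (st s o zero)      = ℚₚ.≤-refl
0≤potential (st s o x@(suc _)) = 0≤Ψ (0≤ι s) (0≤ι o) (0≤ι x) (proj₁ W-bounds) (proj₂ W-bounds)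
  where W-bounds = corrector-bounded (16 ℕ.* (s ℕ.+ o ℕ.+ x)) x

value : Maybe State → ℚ
value nothing  = 0ℚ
value (just τ) = potential τ

successorTotal : State → ℚ
successorTotal σ = value (spin Nisht σ) + value (spin Ganz σ) + value (spin Halb σ) + value (spin Shtel σ)

ganz-value≤ : ∀ s o y → value (spin Ganz (st s o (suc y)))
              ≤ Ψ (ι o - 1ℚ) (ι s + ι (suc y) - 1ℚ) (ι 2) (corrector (16 ℕ.* (s ℕ.+ o ℕ.+ suc y)) 2)
ganz-value≤ s zero    y rewrite ℕₚ.+-suc s y =
  0≤Ψ-after-failed-ante (subst (0ℚ ≤_) (ι-+-pred s y) (0≤ι (s ℕ.+ y)))
                        (proj₂ (corrector-bounded (16 ℕ.* (s ℕ.+ 0 ℕ.+ suc y)) 2))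
ganz-value≤ s (suc o) y rewrite ℕₚ.+-suc s y = ℚₚ.≤-reflexive (begin
  potential (st o (s ℕ.+ y) 2)
    ≡⟨ potential-at {o} {s ℕ.+ y} (s≤s z≤n) (rearrange o s y) ⟩
  Ψ (ι o) (ι (s ℕ.+ y)) (ι 2) (corrector m 2)
    ≡⟨ cong₂ (λ u v → Ψ u v (ι 2) (corrector m 2)) (ι-pred o) (ι-+-pred s y) ⟩
  Ψ (ι (suc o) - 1ℚ) (ι s + ι (suc y) - 1ℚ) (ι 2) (corrector m 2) ∎)
  where
  open ≡-Reasoning
  m = 16 ℕ.* (s ℕ.+ suc o ℕ.+ suc y)
  rearrange : ∀ o s y → o ℕ.+ (s ℕ.+ y) ℕ.+ 2 ≡ s ℕ.+ (1 ℕ.+ o) ℕ.+ (1 ℕ.+ y)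
  rearrange = ℕ-ring

shtel-value≤ : ∀ s o y → value (spin Shtel (st s o (suc y)))
               ≤ Ψ (ι o) (ι s - 1ℚ) (ι (suc y) + 1ℚ) (corrector (16 ℕ.* (s ℕ.+ o ℕ.+ suc y)) (suc (suc y)))
shtel-value≤ zero    o y =
  subst (λ X → 0ℚ ≤ Ψ (ι o) (0ℚ - 1ℚ) (X + 1ℚ) (corrector m (suc (suc y)))) (sym (ι-suc y))
        (0≤Ψ-after-failed-shtel (0≤ι o) (0≤ι y) (proj₁ (corrector-bounded m (suc (suc y)))))
  where m = 16 ℕ.* (0 ℕ.+ o ℕ.+ suc y)
shtel-value≤ (suc s) o y = ℚₚ.≤-reflexive (begin
  potential (st o s (suc (suc y)))
    ≡⟨ potential-at {o} {s} (s≤s z≤n) (rearrange o s y) ⟩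
  Ψ (ι o) (ι s) (ι (suc (suc y))) (corrector m (suc (suc y)))
    ≡⟨ cong₂ (λ u v → Ψ (ι o) u v (corrector m (suc (suc y)))) (ι-pred s)
             (trans (ι-suc (suc y)) (ℚₚ.+-comm 1ℚ (ι (suc y)))) ⟩
  Ψ (ι o) (ι (suc s) - 1ℚ) (ι (suc y) + 1ℚ) (corrector m (suc (suc y))) ∎)
  where
  open ≡-Reasoning
  m = 16 ℕ.* (suc s ℕ.+ o ℕ.+ suc y)
  rearrange : ∀ o s y → o ℕ.+ s ℕ.+ (2 ℕ.+ y) ≡ (1 ℕ.+ s) ℕ.+ o ℕ.+ (1 ℕ.+ y)
  rearrange = ℕ-ring

module _ (s o y : ℕ) where
  private
    x = suc y
    σ = st s o x
    m = 16 ℕ.* (s ℕ.+ o ℕ.+ x)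
    W = corrector m
    S = ι s
    O = ι o
    X = ι x
    H = ι (x ℕ./ 2)
    E = ι (x % 2)

  nisht-value : value (spin Nisht σ) ≡ Ψ O S X (W x)
  nisht-value = potential-at {o} {s} (s≤s z≤n) (cong (ℕ._+ x) (ℕₚ.+-comm o s))

  halb-value : value (spin Halb σ) ≡ Ψ O (S + H) (H + E) (W (halbPot x))
  halb-value = begin
    value (finish (s ℕ.+ x ℕ./ 2) o (halbPot x))
      ≡⟨ cong value (pot-nonempty (halbPot x) 0<pot) ⟩
    potential (st o (s ℕ.+ x ℕ./ 2) (halbPot x))
      ≡⟨ potential-at 0<pot tokens-preserved ⟩
    Ψ O (ι (s ℕ.+ x ℕ./ 2)) (ι (halbPot x)) (W (halbPot x))
      ≡⟨ cong₂ (λ u v → Ψ O u v (W (halbPot x))) (ι-+ s (x ℕ./ 2)) (ι-halbPot x) ⟩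
    Ψ O (S + H) (H + E) (W (halbPot x)) ∎
    where
    open ≡-Reasoning
    0<pot : 1 ℕ.≤ halbPot x
    0<pot = ℕₚ.m<n⇒0<n∸m (ℕ÷.m/n<m x 2 (s≤s (s≤s z≤n)))
    pot-nonempty : ∀ z → 1 ℕ.≤ z → finish (s ℕ.+ x ℕ./ 2) o z ≡ just (st o (s ℕ.+ x ℕ./ 2) z)
    pot-nonempty (suc _) _ = refl
    rearrange : ∀ o s h c → o ℕ.+ (s ℕ.+ h) ℕ.+ c ≡ s ℕ.+ o ℕ.+ (c ℕ.+ h)
    rearrange = ℕ-ring
    tokens-preserved : o ℕ.+ (s ℕ.+ x ℕ./ 2) ℕ.+ halbPot x ≡ s ℕ.+ o ℕ.+ x
    tokens-preserved = trans (rearrange o s (x ℕ./ 2) (halbPot x))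
                             (cong (s ℕ.+ o ℕ.+_) (ℕₚ.m∸n+n≡m (ℕ÷.m/n≤m x 2)))

  depth-bound : ι 16 * ¾^ (double m) * (S + O) ≤ ι 2
  depth-bound = ℚₚ.≤-trans (≤-by-slack (g * (1ℚ + ι 16 * X)) (begin
      ι (suc m) * g                             ≡⟨ cong (_* g) ι-depth ⟩
      (1ℚ + ι 16 * (S + O + X)) * g             ≡⟨ identity g S O X ⟩
      ι 16 * g * (S + O) + g * (1ℚ + ι 16 * X)  ∎)
    (0≤* (0≤¾^ (double m)) (0≤+ (≤-decide 0ℚ 1ℚ) (0≤* (0≤ι 16) (0≤ι x)))))
    (linear*¾^double≤2 m)
    where
    open ≡-Reasoning
    g = ¾^ (double m)
    ι-depth : ι (suc m) ≡ 1ℚ + ι 16 * (S + O + X)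
    ι-depth = trans (ι-suc m) (cong (_+_ 1ℚ) (trans (ι-* 16 (s ℕ.+ o ℕ.+ x))
                (cong (_*_ (ι 16)) (trans (ι-+ (s ℕ.+ o) x) (cong (_+ X) (ι-+ s o))))))
    identity : ∀ g S O X → (1ℚ + ι 16 * (S + O + X)) * g ≡ ι 16 * g * (S + O) + g * (1ℚ + ι 16 * X)
    identity = solve-∀ ℚ-ring

  potential-drift : successorTotal σ + ι 40 ≤ ι 4 * potential σ
  potential-drift = begin
    successorTotal σ + ι 40
      ≤⟨ ℚₚ.+-monoˡ-≤ (ι 40) (ℚₚ.+-mono-≤ (ℚₚ.+-mono-≤ (ℚₚ.+-mono-≤
           (ℚₚ.≤-reflexive nisht-value) (ganz-value≤ s o y)) (ℚₚ.≤-reflexive halb-value)) (shtel-value≤ s o y)) ⟩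
    successors X + ι 40
      ≡⟨ cong (λ X → successors X + ι 40) (ι-halving x) ⟩
    Ψ-successors S O H E (W x) (W 2) (W (halbPot x)) (W (suc x)) + ι 40
      ≤⟨ Ψ-drift {wx = W x} {a = smoothedParity (double m) x} {b = smoothedParity (suc (double m)) x}
                 (0≤ι s) (0≤ι o) (0≤ι (x ℕ./ 2)) (0≤ι (x % 2)) (parity≤1 x) (ι≤ι*ι (x ℕ./ 2))
                 (proj₁ (corrector-bounded m 2)) (proj₁ (corrector-bounded m (halbPot x)))
                 (proj₂ (corrector-bounded m (suc x)))
                 (corrector-equation m x) (proj₂ T-step) (proj₁ T-step) depth-bound ⟩
    ι 4 * Ψ S O (H + H + E) (W x)
      ≡⟨ cong (λ X → ι 4 * Ψ S O X (W x)) (ι-halving x) ⟨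
    ι 4 * potential σ ∎
    where
    open ℚₚ.≤-Reasoning
    T-step = smoothedParity-step (double m) x
    successors : ℚ → ℚ
    successors X = Ψ O S X (W x) + Ψ (O - 1ℚ) (S + X - 1ℚ) (ι 2) (W 2)
                 + Ψ O (S + H) (H + E) (W (halbPot x)) + Ψ O (S - 1ℚ) (X + 1ℚ) (W (suc x))

-- Drift of the expected potential

expectedPotential : Dist → ℚ
expectedPotential []            = 0ℚ
expectedPotential ((σ , p) ∷ d) = p * potential σ + expectedPotential d

Live : State × ℚ → Set
Live (σ , p) = 0ℚ ≤ p × 1 ℕ.≤ State.pot σ

outcome : Maybe State → ℚ → Dist
outcome nothing  _ = []
outcome (just τ) q = (τ , q) ∷ []

outcomes : State → ℚ → Dist
outcomes σ p = concatMap (λ side → outcome (spin side σ) (quarter * p)) (Nisht ∷ Ganz ∷ Halb ∷ Shtel ∷ [])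

-- `step` filters finished games through a local function that only computes once the
-- results of the four spins are known; hence the case split.
step-∷ : ∀ σ p d → step ((σ , p) ∷ d) ≡ outcomes σ p ++ step d
step-∷ σ p d with spin Nisht σ | spin Ganz σ | spin Halb σ | spin Shtel σ
... | nothing | nothing | nothing | nothing = refl
... | nothing | nothing | nothing | just _  = refl
... | nothing | nothing | just _  | nothing = refl
... | nothing | nothing | just _  | just _  = refl
... | nothing | just _  | nothing | nothing = refl
... | nothing | just _  | nothing | just _  = refl
... | nothing | just _  | just _  | nothing = refl
... | nothing | just _  | just _  | just _  = refl
... | just _  | nothing | nothing | nothing = refl
... | just _  | nothing | nothing | just _  = refl
... | just _  | nothing | just _  | nothing = refl
... | just _  | nothing | just _  | just _  = refl
... | just _  | just _  | nothing | nothing = refl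
... | just _  | just _  | nothing | just _  = refl
... | just _  | just _  | just _  | nothing = refl
... | just _  | just _  | just _  | just _  = refl

expectedPotential-++ : ∀ d e → expectedPotential (d ++ e) ≡ expectedPotential d + expectedPotential e
expectedPotential-++ []            e = sym (ℚₚ.+-identityˡ (expectedPotential e))
expectedPotential-++ ((σ , p) ∷ d) e =
  trans (cong (_+_ (p * potential σ)) (expectedPotential-++ d e))
        (sym (ℚₚ.+-assoc (p * potential σ) (expectedPotential d) (expectedPotential e)))

expectedPotential-outcome : ∀ m q d → expectedPotential (outcome m q ++ d) ≡ q * value m + expectedPotential d
expectedPotential-outcome nothing  q d =
  sym (trans (cong (_+ expectedPotential d) (ℚₚ.*-zeroʳ q)) (ℚₚ.+-identityˡ (expectedPotential d)))
expectedPotential-outcome (just τ) q d = refl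

expectedPotential-outcomes : ∀ σ p → expectedPotential (outcomes σ p) ≡ quarter * p * successorTotal σ
expectedPotential-outcomes σ p = begin
  expectedPotential (outcome n q ++ (outcome g q ++ (outcome h q ++ (outcome t q ++ []))))
    ≡⟨ expectedPotential-outcome n q _ ⟩
  q * value n + expectedPotential (outcome g q ++ (outcome h q ++ (outcome t q ++ [])))
    ≡⟨ cong (_+_ (q * value n)) (expectedPotential-outcome g q _) ⟩
  q * value n + (q * value g + expectedPotential (outcome h q ++ (outcome t q ++ [])))
    ≡⟨ cong (λ r → q * value n + (q * value g + r)) (expectedPotential-outcome h q _) ⟩
  q * value n + (q * value g + (q * value h + expectedPotential (outcome t q ++ [])))
    ≡⟨ cong (λ r → q * value n + (q * value g + (q * value h + r))) (expectedPotential-outcome t q []) ⟩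
  q * value n + (q * value g + (q * value h + (q * value t + 0ℚ)))
    ≡⟨ distrib q (value n) (value g) (value h) (value t) ⟩
  q * successorTotal σ ∎
  where
  open ≡-Reasoning
  q = quarter * p
  n = spin Nisht σ
  g = spin Ganz σ
  h = spin Halb σ
  t = spin Shtel σ
  distrib : ∀ q a b c d → q * a + (q * b + (q * c + (q * d + 0ℚ))) ≡ q * (a + b + c + d)
  distrib = solve-∀ ℚ-ring

finish-pot : ∀ a b x {τ} → finish a b x ≡ just τ → 1 ℕ.≤ State.pot τ
finish-pot (suc a) (suc b) zero    refl = s≤s z≤n
finish-pot a       b       (suc x) refl = s≤s z≤n

spin-pot : ∀ side σ {τ} → spin side σ ≡ just τ → 1 ℕ.≤ State.pot τ
spin-pot Nisht (st s o x)       = finish-pot s o x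
spin-pot Ganz  (st s o x)       = finish-pot (s ℕ.+ x) o 0
spin-pot Halb  (st s o x)       = finish-pot (s ℕ.+ x ℕ./ 2) o (halbPot x)
spin-pot Shtel (st (suc s) o x) = finish-pot s o (suc x)

outcome-live : ∀ side σ {q} → 0ℚ ≤ q → All Live (outcome (spin side σ) q)
outcome-live side σ 0≤q with spin side σ in eq
... | nothing = []
... | just τ  = (0≤q , spin-pot side σ eq) ∷ []

outcomes-live : ∀ σ {p} → 0ℚ ≤ p → All Live (outcomes σ p)
outcomes-live σ 0≤p = ++⁺ (outcome-live Nisht σ 0≤q) (++⁺ (outcome-live Ganz σ 0≤q)
                       (++⁺ (outcome-live Halb σ 0≤q) (++⁺ (outcome-live Shtel σ 0≤q) [])))
  where 0≤q = 0≤* (≤-decide 0ℚ quarter) 0≤p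

outcomes-drift : ∀ σ p → Live (σ , p) → expectedPotential (outcomes σ p) + ι 10 * p ≤ p * potential σ
outcomes-drift σ@(st s o (suc y)) p (0≤p , _) =
  ≤-by-slack slack
    (trans (regroup p (successorTotal σ) (potential σ))
           (cong (λ r → r + ι 10 * p + slack) (sym (expectedPotential-outcomes σ p))))
    (0≤* (0≤* (≤-decide 0ℚ quarter) 0≤p) (p≤q⇒0≤q-p (potential-drift s o y)))
  where
  slack = quarter * p * (ι 4 * potential σ - (successorTotal σ + ι 40))
  regroup : ∀ p L F → p * F ≡ quarter * p * L + ι 10 * p + quarter * p * (ι 4 * F - (L + ι 40))
  regroup = solve-∀ ℚ-ring

step-drift : ∀ d → All Live d →
             All Live (step d) × expectedPotential (step d) + ι 10 * mass d ≤ expectedPotential d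
step-drift []            []                          = [] , ℚₚ.≤-refl
step-drift ((σ , p) ∷ d) (live@(0≤p , _) ∷ live-d) rewrite step-∷ σ p d =
    ++⁺ (outcomes-live σ 0≤p) (proj₁ ih)
  , (begin
      expectedPotential (outcomes σ p ++ step d) + ι 10 * (p + mass d)
        ≡⟨ cong (_+ ι 10 * (p + mass d)) (expectedPotential-++ (outcomes σ p) (step d)) ⟩
      (expectedPotential (outcomes σ p) + expectedPotential (step d)) + ι 10 * (p + mass d)
        ≡⟨ regroup (expectedPotential (outcomes σ p)) (expectedPotential (step d)) p (mass d) ⟩
      (expectedPotential (outcomes σ p) + ι 10 * p) + (expectedPotential (step d) + ι 10 * mass d)
        ≤⟨ ℚₚ.+-mono-≤ (outcomes-drift σ p live) (proj₂ ih) ⟩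
      p * potential σ + expectedPotential d ∎)
  where
  open ℚₚ.≤-Reasoning
  ih = step-drift d live-d
  regroup : ∀ a b p m → (a + b) + ι 10 * (p + m) ≡ (a + ι 10 * p) + (b + ι 10 * m)
  regroup = solve-∀ ℚ-ring

iter-drift : ∀ N t → All Live (iter t (initial N))
                   × ι 10 * truncatedExpectedSpins N t + expectedPotential (iter t (initial N))
                     ≤ expectedPotential (initial N)
iter-drift N zero    = ((≤-decide 0ℚ 1ℚ , s≤s z≤n) ∷ []) , ℚₚ.≤-reflexive (ℚₚ.+-identityˡ _)
iter-drift N (suc t) = proj₁ step-t , (begin
    ι 10 * (E + mass d) + expectedPotential (step d)
      ≡⟨ regroup E (mass d) (expectedPotential (step d)) ⟩
    ι 10 * E + (expectedPotential (step d) + ι 10 * mass d)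
      ≤⟨ ℚₚ.+-monoʳ-≤ (ι 10 * E) (proj₂ step-t) ⟩
    ι 10 * E + expectedPotential d
      ≤⟨ proj₂ ih ⟩
    expectedPotential (initial N) ∎)
  where
  open ℚₚ.≤-Reasoning
  ih = iter-drift N t
  d = iter t (initial N)
  E = truncatedExpectedSpins N t
  step-t = step-drift d (proj₁ ih)
  regroup : ∀ e m φ → ι 10 * (e + m) + φ ≡ ι 10 * e + (φ + ι 10 * m)
  regroup = solve-∀ ℚ-ring

0≤expectedPotential : ∀ d → All Live d → 0ℚ ≤ expectedPotential d
0≤expectedPotential []            []                 = ℚₚ.≤-refl
0≤expectedPotential ((σ , p) ∷ d) ((0≤p , _) ∷ live) = 0≤+ (0≤* 0≤p (0≤potential σ)) (0≤expectedPotential d live)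

expectedSpins-bound : ∀ N t → ι 10 * truncatedExpectedSpins N t ≤ expectedPotential (initial N)
expectedSpins-bound N t = ℚₚ.≤-trans
  (≤-by-slack (expectedPotential (iter t (initial N))) refl (0≤expectedPotential _ (proj₁ (iter-drift N t))))
  (proj₂ (iter-drift N t))

initial-potential : ∀ k → expectedPotential (initial (suc k)) ≡ ι 104 * ι k * ι k + ι 290 * ι k + ι 240
initial-potential k = symmetric (ι k) (corrector (16 ℕ.* (k ℕ.+ k ℕ.+ 2)) 2)
  where
  symmetric : withΨ λ Ψ → ∀ K w → 1ℚ * Ψ K K (ι 2) w + 0ℚ ≡ ι 104 * K * K + ι 290 * K + ι 240
  symmetric = solve-∀ ℚ-ring

quadratic-bound : ∀ {K ε} → 0ℚ ≤ K → 0ℚ ≤ ε →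
                  ι 104 * K * K + ι 290 * K + ι 240 ≤ ι 10 * ((+ 104 / 3 + ε) * ((1ℚ + K) * (1ℚ + K)))
quadratic-bound {K} {ε} 0≤K 0≤ε = ≤-by-slack slack (expand K ε)
  (0≤+ (0≤+ (0≤+ (0≤* (0≤* (≤-decide 0ℚ (+ 728 / 3)) 0≤K) 0≤K) (0≤* (≤-decide 0ℚ (+ 1210 / 3)) 0≤K))
             (≤-decide 0ℚ (+ 320 / 3)))
       (0≤* (0≤* (0≤ι 10) 0≤ε) (0≤* 0≤1+K 0≤1+K)))
  where
  slack = + 728 / 3 * K * K + + 1210 / 3 * K + + 320 / 3 + ι 10 * ε * ((1ℚ + K) * (1ℚ + K))
  0≤1+K = 0≤+ (≤-decide 0ℚ 1ℚ) 0≤K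
  expand : ∀ K ε → ι 10 * ((+ 104 / 3 + ε) * ((1ℚ + K) * (1ℚ + K)))
                 ≡ ι 104 * K * K + ι 290 * K + ι 240
                   + (+ 728 / 3 * K * K + + 1210 / 3 * K + + 320 / 3 + ι 10 * ε * ((1ℚ + K) * (1ℚ + K)))
  expand = solve-∀ ℚ-ring

mainTheorem2 : (ε : ℚ) → 0ℚ < ε →
    ∃[ N₀ ] ((N : ℕ) → N ≥ N₀ → (t : ℕ) →
      truncatedExpectedSpins N t ≤ (+ 104 / 3 + ε) * (+ (N ^ 2) / 1))
mainTheorem2 ε 0<ε = 1 , bound
  where
  bound : (N : ℕ) → N ≥ 1 → (t : ℕ) → truncatedExpectedSpins N t ≤ (+ 104 / 3 + ε) * ι (N ^ 2)
  bound N@(suc k) _ t = ℚₚ.*-cancelˡ-≤-pos (ι 10) (begin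
    ι 10 * truncatedExpectedSpins N t                     ≤⟨ expectedSpins-bound N t ⟩
    expectedPotential (initial N)                         ≡⟨ initial-potential k ⟩
    ι 104 * ι k * ι k + ι 290 * ι k + ι 240               ≤⟨ quadratic-bound (0≤ι k) (ℚₚ.<⇒≤ 0<ε) ⟩
    ι 10 * ((+ 104 / 3 + ε) * ((1ℚ + ι k) * (1ℚ + ι k)))  ≡⟨ cong (λ r → ι 10 * ((+ 104 / 3 + ε) * (r * r))) (ι-suc k) ⟨
    ι 10 * ((+ 104 / 3 + ε) * (ι N * ι N))                ≡⟨ cong (λ r → ι 10 * ((+ 104 / 3 + ε) * r)) (ι-square N) ⟨
    ι 10 * ((+ 104 / 3 + ε) * ι (N ^ 2))                  ∎)
    where open ℚₚ.≤-Reasoning
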